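{- Let $B$ be a permutation branching program of length $n$ and let $H\subseteq\{0,1\}^n$. Then for every $x\in\{0,1\}^n$, \[B_H(x)=\bigwedge_{i=0}^{n}\Big(\bigvee_{y\in H}B(x_{1..i}\,\|\,y_{i+1..n})\Big),\] where $\|$ denotes string concatenation and $x_{1..0}$ and $y_{n+1..n}$ denote the empty string.
   Context: A permutation branching program $B$ of length $n$ and width $w$ has layers $V_0,\dots,V_n$, each a copy of $\{1,\dots,w\}$, a start state $v_0\in V_0$, transition functions $B_r:V_{r-1}\times\{0,1\}\to V_r$ ($r=1,\dots,n$) such that each $B_r(\cdot,b)$ is a permutation, and a set $V_{\mathit{acc}}\subseteq V_n$ of accept vertices. For $v\in V_i$, $x\in\{0,1\}^k$, $i+k\le n$, $B[v,x]\in V_{i+k}$ is the state reached from $v$ reading $x$; $B(x)=1$ iff $B[v_0,x]\in V_{\mathit{acc}}$. Induced hit program: for $i=0,\dots,n$ let $K_i=\{v\in V_i:\exists y\in H,\ B[v,y_{1..n-i}]\in V_{\mathit{acc}}\}$, let $K=\max_i|K_i|$, and pad each $K_i$ with fresh padding states to a set $K_i'$ of size $K$. Layer $i$ of $B_H$ is $W_i=K_i'\cup(\{0,\dots,n\}\times[K])$. Fix bijections $\iota_i:K_i'\to[K]$. The transition $W_i\to W_{i+1}$ on bit $b$ sends $v\in K_i$ to $B_{i+1}(v,b)$ if that lies in $K_{i+1}$ and to $(i,\iota_i(v))$ otherwise; sends a padding state $p$ to $(i,\iota_i(p))$; sends $(j,u)$, $j\ne i$, to $(j,u)$; and on states $(i,u)$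 is defined arbitrarily so that the map is a bijection. The accept set is $K_n\cap V_{\mathit{acc}}$; the start state is $v_0$ if $v_0\in K_0$, otherwise $(n,1)$ (so $B_H$ rejects everything). $B_H(x)$ denotes the output of $B_H$ on $x$. -}

module Defs where

open import Data.Nat using (ℕ; zero; suc; _<_; _≤_; _∸_; _⊔_; _+_; _≡ᵇ_)
open import Data.Nat.Properties using (_<?_; <-trans; n<1+n; ≤-refl)
open import Data.Fin using (Fin; toℕ; fromℕ<)
open import Data.Bool using (Bool; true; false; if_then_else_; T; _∧_; _∨_)
open import Data.Bool.Properties using (T?)
open import Data.List using (List; []; _∷_; allFin; map; foldr; upTo; take; drop; _++_)
open import Data.Bool.ListAction using (any; all)
open import Data.Nat.ListAction using (sum)
open import Data.Vec using (Vec; toList; lookup)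
open import Data.Sum using (_⊎_; inj₁; inj₂)
open import Data.Product using (_×_; _,_)
open import Relation.Nullary using (yes; no)
open import Relation.Binary.PropositionalEquality using (_≡_)
open import Function.Definitions using (Bijective)

-- States of every layer V_i are Fin w.  The transition B_{r+1} (r = 0..n-1)
-- is  δ r : Fin w → Bool → Fin w  (indexing by Fin n, shifted by one).
record PBP (n w : ℕ) : Set where
  field
    δ     : Fin n → Fin w → Bool → Fin w
    perm  : ∀ r b → Bijective _≡_ _≡_ (λ v → δ r v b)
    start : Fin w
    acc   : Fin w → Bool          -- indicator of V_acc ⊆ V_n

module Program {n w : ℕ} (B : PBP n w) where
  open PBP B

  -- transition out of layer i (used only for i < n)
  δ' : ℕ → Fin w → Bool → Fin w
  δ' i v b with i <? n
  ... | yes p = δ (fromℕ< p) v b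
  ... | no _  = v

  runFrom : ℕ → Fin w → List Bool → Fin w
  runFrom i v []       = v
  runFrom i v (b ∷ xs) = runFrom (suc i) (δ' i v b) xs

  eval : List Bool → Bool
  eval xs = acc (runFrom 0 start xs)

  rhs : List (Vec Bool n) → Vec Bool n → Bool
  rhs H x = all (λ i → any (λ y → eval (take i (toList x) ++ drop i (toList y))) H)
                (upTo (suc n))

module Hit {n w : ℕ} (B : PBP n w) (H : List (Vec Bool n)) where
  open PBP B
  open Program B public

  inK : ℕ → Fin w → Bool
  inK i v = any (λ y → acc (runFrom i v (drop i (toList y)))) H

  cnt : ℕ → ℕ
  cnt i = sum (map (λ v → if inK i v then 1 else 0) (allFin w))

  K : ℕ
  K = foldr _⊔_ 0 (map cnt (upTo (suc n)))

  data Kp (i : ℕ) : Set where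
    korig : (v : Fin w) → T (inK i v) → Kp i
    kpad  : Fin (K ∸ cnt i) → Kp i

  W : ℕ → Set
  W i = Kp i ⊎ (Fin (suc n) × Fin K)

  -- Given the bijections ι_i : K_i' → [K] and the (arbitrary) values of the
  -- transition on the states (i,u), the transition W_i → W_{i+1} on bit b.
  module Trans (ι : (i : ℕ) → Kp i → Fin K)
               (comp : (i : ℕ) → Bool → Fin K → W (suc i)) where

    step : (i : ℕ) → i < n → Bool → W i → W (suc i)
    step i p b (inj₁ (korig v r)) with T? (inK (suc i) (δ (fromℕ< p) v b))
    ... | yes q = inj₁ (korig (δ (fromℕ< p) v b) q)
    ... | no _  = inj₂ (fromℕ< (<-trans p (n<1+n n)) , ι i (korig v r))
    step i p b (inj₁ (kpad q)) = inj₂ (fromℕ< (<-trans p (n<1+n n)) , ι i (kpad q))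
    step i p b (inj₂ (j , u)) with toℕ j ≡ᵇ i
    ... | true  = comp i b u
    ... | false = inj₂ (j , u)

    stateAt : Vec Bool n → W 0 → (i : ℕ) → i ≤ n → W i
    stateAt x s₀ zero    _ = s₀
    stateAt x s₀ (suc i) p = step i p (lookup x (fromℕ< p)) (stateAt x s₀ i (lowerle p))
      where
        lowerle : ∀ {a b} → suc a ≤ b → a ≤ b
        lowerle (Data.Nat.s≤s q) = Data.Nat.Properties.m≤n⇒m≤1+n q

    accepts : W n → Bool
    accepts (inj₁ (korig v _)) = acc v
    accepts (inj₁ (kpad _))    = false
    accepts (inj₂ _)           = false

    -- B_H(x).  If v₀ ∉ K_0 the start state is the sink (n,1) and B_H rejects
    -- every input; we return false directly in that case.
    evalH : Vec Bool n → Bool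
    evalH x with T? (inK 0 start)
    ... | yes q = accepts (stateAt x (inj₁ (korig start q)) n ≤-refl)
    ... | no _  = false

{-# OPTIONS --safe #-}
module Submission where

-- Let v_i be the state of B after reading x_{1..i}.  Splitting the input at i,
-- the i-th disjunct of the right-hand side says exactly that v_i ∈ K_i.  By
-- induction on i, after reading x_{1..i} the hit program B_H is at v_i as long
-- as v_j ∈ K_j for every j ≤ i; otherwise it has fallen into some state (j,u)
-- with j < i, which no later transition moves.  Finally v_n ∈ K_n already forces
-- v_n to be accepting, since the suffixes of length 0 are empty.

open import Defs
open import Data.Nat using (ℕ; zero; suc; _<_; _≤_; _+_; _⊓_; _≡ᵇ_; z≤n; s≤s)
open import Data.Nat.Properties
  using (_<?_; ≡ᵇ⇒≡; <⇒≢; <⇒≤; ≤-refl; ≤-reflexive; ≤-pred; m≤n⇒m≤1+n; m≤n⇒m<n∨m≡n;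
         m≤n⇒m⊓n≡m; +-identityʳ; +-suc)
open import Data.Fin using (Fin; toℕ; fromℕ<)
open import Data.Fin.Properties using (toℕ-fromℕ<)
open import Data.Bool using (Bool; true; false; T)
open import Data.Bool.Properties using (T?; T-≡)
open import Data.Bool.ListAction using (any; or)
open import Data.List using (List; []; _∷_; _++_; length; take; drop; upTo)
open import Data.List.Properties using (length-take; drop-all; map-cong)
open import Data.List.Relation.Unary.Any using (satisfied)
open import Data.List.Relation.Unary.Any.Properties using (any⁻)
open import Data.List.Relation.Unary.All.Properties using (all⁺; all⁻; applyUpTo⁺₁; applyUpTo⁻)
open import Data.Vec using (Vec; toList; lookup; _∷_)
open import Data.Vec.Properties using (length-toList)
open import Data.Sum using (inj₁; inj₂)
open import Data.Product using (_,_)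
open import Data.Empty using (⊥-elim)
open import Function using (id; _∘_)
open import Function.Bundles using (_⇔_; mk⇔; Equivalence)
open import Function.Definitions using (Bijective)
open import Relation.Nullary using (¬_; yes; no; contradiction)
open import Relation.Binary.PropositionalEquality
  using (_≡_; refl; sym; trans; cong; subst; module ≡-Reasoning)

T-⇔⇒≡ : ∀ {a b} → T a ⇔ T b → a ≡ b
T-⇔⇒≡ {false} {false} _  = refl
T-⇔⇒≡ {false} {true}  a⇔b = contradiction _ (Equivalence.from a⇔b)
T-⇔⇒≡ {true}  {false} a⇔b = contradiction _ (Equivalence.to a⇔b)
T-⇔⇒≡ {true}  {true}  _  = refl

module _ {A : Set} where

  take-suc-toList : ∀ {n} (x : Vec A n) i (p : i < n) →
                    take (suc i) (toList x) ≡ take i (toList x) ++ lookup x (fromℕ< p) ∷ []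
  take-suc-toList (a ∷ x) zero    _       = refl
  take-suc-toList (a ∷ x) (suc i) (s≤s p) = cong (a ∷_) (take-suc-toList x i p)

  length-take-toList : ∀ {n i} (x : Vec A n) → i ≤ n → length (take i (toList x)) ≡ i
  length-take-toList {n} {i} x i≤n = begin
    length (take i (toList x))    ≡⟨ length-take i (toList x) ⟩
    i ⊓ length (toList x)         ≡⟨ cong (i ⊓_) (length-toList x) ⟩
    i ⊓ n                         ≡⟨ m≤n⇒m⊓n≡m i≤n ⟩
    i                             ∎
    where open ≡-Reasoning

  drop-toList : ∀ {n} (y : Vec A n) → drop n (toList y) ≡ []
  drop-toList {n} y = drop-all n (toList y) (≤-reflexive (length-toList y))

module _ {n w : ℕ} (B : PBP n w) where
  open PBP B
  open Program B

  δ'-< : ∀ {i} (p : i < n) v b → δ' i v b ≡ δ (fromℕ< p) v b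
  δ'-< {i} p v b with i <? n
  ... | yes _  = refl
  ... | no i≮n = contradiction p i≮n

  runFrom-++ : ∀ i v xs ys → runFrom i v (xs ++ ys) ≡ runFrom (i + length xs) (runFrom i v xs) ys
  runFrom-++ i v []       ys = cong (λ k → runFrom k v ys) (sym (+-identityʳ i))
  runFrom-++ i v (b ∷ xs) ys =
    trans (runFrom-++ (suc i) (δ' i v b) xs ys)
          (cong (λ k → runFrom k (runFrom (suc i) (δ' i v b) xs) ys) (sym (+-suc i (length xs))))

  module _ (x : Vec Bool n) where

    trace : ℕ → Fin w
    trace i = runFrom 0 start (take i (toList x))

    eval-prefix : ∀ {i} → i ≤ n → ∀ ys → eval (take i (toList x) ++ ys) ≡ acc (runFrom i (trace i) ys)
    eval-prefix {i} i≤n ys = cong acc (trans (runFrom-++ 0 start (take i (toList x)) ys)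
      (cong (λ k → runFrom k (trace i) ys) (length-take-toList x i≤n)))

    trace-suc : ∀ {i} (p : i < n) → trace (suc i) ≡ δ (fromℕ< p) (trace i) (lookup x (fromℕ< p))
    trace-suc {i} p = begin
      trace (suc i)                                ≡⟨ cong (runFrom 0 start) (take-suc-toList x i p) ⟩
      runFrom 0 start (take i (toList x) ++ b ∷ [])  ≡⟨ runFrom-++ 0 start (take i (toList x)) (b ∷ []) ⟩
      δ' (length (take i (toList x))) (trace i) b  ≡⟨ cong (λ k → δ' k (trace i) b) (length-take-toList x (<⇒≤ p)) ⟩
      δ' i (trace i) b                             ≡⟨ δ'-< p (trace i) b ⟩
      δ (fromℕ< p) (trace i) b                     ∎
      where
      open ≡-Reasoning
      b : Bool
      b = lookup x (fromℕ< p)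

module _ {n w : ℕ} (B : PBP n w) (H : List (Vec Bool n)) where
  open PBP B
  open Hit B H

  acc-of-inK-last : ∀ {v} → T (inK n v) → T (acc v)
  acc-of-inK-last {v} v∈Kₙ with y , acc-run ← satisfied (any⁻ _ H v∈Kₙ) =
    subst (λ ys → T (acc (runFrom n v ys))) (drop-toList y) acc-run

  module _ (x : Vec Bool n) where

    Survives : ℕ → Set
    Survives i = ∀ {j} → j ≤ i → T (inK j (trace B x j))

    Survives-suc : ∀ {i} → Survives i → T (inK (suc i) (trace B x (suc i))) → Survives (suc i)
    Survives-suc S last j≤1+i with m≤n⇒m<n∨m≡n j≤1+i
    ... | inj₁ j<1+i = S (≤-pred j<1+i)
    ... | inj₂ refl  = last

    ¬Survives-suc : ∀ {i} → ¬ Survives i → ¬ Survives (suc i)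
    ¬Survives-suc ¬S S = ¬S (S ∘ m≤n⇒m≤1+n)

    disjunct : ℕ → Bool
    disjunct i = any (λ y → eval (take i (toList x) ++ drop i (toList y))) H

    disjunct≡inK : ∀ {i} → i ≤ n → disjunct i ≡ inK i (trace B x i)
    disjunct≡inK {i} i≤n = cong or (map-cong (λ y → eval-prefix B x i≤n (drop i (toList y))) H)

    T-rhs⇔Survives : T (rhs H x) ⇔ Survives n
    T-rhs⇔Survives = mk⇔
      (λ t {j} j≤n → subst T (disjunct≡inK j≤n)
                   (applyUpTo⁻ id (suc n) (all⁺ disjunct (upTo (suc n)) t) (s≤s j≤n)))
      (λ S → all⁻ disjunct (applyUpTo⁺₁ id (suc n) λ {j} j<1+n →
                   subst T (sym (disjunct≡inK (≤-pred j<1+n))) (S (≤-pred j<1+n))))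

  module _ (ι : (i : ℕ) → Kp i → Fin K) (comp : (i : ℕ) → Bool → Fin K → W (suc i)) where
    open Trans ι comp

    step-sink : ∀ {i} (p : i < n) b {j u} → toℕ j < i → step i p b (inj₂ (j , u)) ≡ inj₂ (j , u)
    step-sink {i} p b {j} j<i with toℕ j ≡ᵇ i in eq
    ... | false = refl
    ... | true  = contradiction (≡ᵇ⇒≡ (toℕ j) i (Equivalence.from T-≡ eq)) (<⇒≢ j<i)

    module _ (x : Vec Bool n) where

      data Follows (i : ℕ) : W i → Set where
        alive : ∀ {v r} → v ≡ trace B x i → Survives x i → Follows i (inj₁ (korig v r))
        dead  : ∀ {j u} → ¬ Survives x i → toℕ j < i → Follows i (inj₂ (j , u))

      Follows-step : ∀ {i s} (p : i < n) → Follows i s →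
                     Follows (suc i) (step i p (lookup x (fromℕ< p)) s)
      Follows-step p (dead ¬S j<i) =
        subst (Follows _) (sym (step-sink p _ j<i)) (dead (¬Survives-suc x ¬S) (m≤n⇒m≤1+n j<i))
      Follows-step {i} p (alive refl S)
        with T? (inK (suc i) (δ (fromℕ< p) (trace B x i) (lookup x (fromℕ< p))))
      ... | yes v∈K = alive (sym (trace-suc B x p))
                            (Survives-suc x S (subst (T ∘ inK (suc i)) (sym (trace-suc B x p)) v∈K))
      ... | no  v∉K = dead (λ S′ → v∉K (subst (T ∘ inK (suc i)) (trace-suc B x p) (S′ ≤-refl)))
                           (≤-reflexive (cong suc (toℕ-fromℕ< _)))

      Follows-stateAt : (q : T (inK 0 start)) → ∀ i (i≤n : i ≤ n) →
                        Follows i (stateAt x (inj₁ (korig start q)) i i≤n)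
      Follows-stateAt q zero    _   = alive refl λ { z≤n → q }
      Follows-stateAt q (suc i) i<n = Follows-step i<n (Follows-stateAt q i _)

      T-accepts⇔Survives : ∀ {s} → Follows n s → T (accepts s) ⇔ Survives x n
      T-accepts⇔Survives (alive refl S) = mk⇔ (λ _ {j} → S {j}) (λ S → acc-of-inK-last (S ≤-refl))
      T-accepts⇔Survives (dead ¬S _)    = mk⇔ (λ ()) (⊥-elim ∘ ¬S)

      T-evalH⇔Survives : T (evalH x) ⇔ Survives x n
      T-evalH⇔Survives with T? (inK 0 start)
      ... | yes q       = T-accepts⇔Survives (Follows-stateAt q n ≤-refl)
      ... | no start∉K₀ = mk⇔ (λ ()) (λ S → start∉K₀ (S z≤n))

lemma3p5 : ∀ {n w} (B : PBP n w) (H : List (Vec Bool n))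
    (ι : (i : ℕ) → Hit.Kp B H i → Fin (Hit.K B H))
    (comp : (i : ℕ) → Bool → Fin (Hit.K B H) → Hit.W B H (suc i))
    → (∀ i → i ≤ n → Bijective _≡_ _≡_ (ι i))
    → (∀ i (p : i < n) b → Bijective _≡_ _≡_ (Hit.Trans.step B H ι comp i p b))
    → ∀ (x : Vec Bool n) → Hit.Trans.evalH B H ι comp x ≡ Program.rhs B H x
lemma3p5 B H ι comp _ _ x = T-⇔⇒≡ (mk⇔
  (Equivalence.from (T-rhs⇔Survives B H x) ∘ Equivalence.to (T-evalH⇔Survives B H ι comp x))
  (Equivalence.from (T-evalH⇔Survives B H ι comp x) ∘ Equivalence.to (T-rhs⇔Survives B H x)))
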